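{- If $\mathcal{C}$ is a Baker class, then $\mathcal{C}^{(d)}$ is a Baker class for every integer $d\ge1$.
   Context: An ordered graph is a finite graph with a linear ordering $\prec$ of its vertices; subgraphs inherit the restricted ordering. A layering of a graph $G$ is a function $\lambda:V(G)\to\mathbb{Z}$ with $|\lambda(u)-\lambda(v)|\le1$ for every edge $uv$; its width is $\sup_i|\lambda^{ -1}(i)|$. For $P\subseteq V(G)$, a layering $\lambda$ of $G[P]$ is $G$-geodesic if $d_G(x,y)\ge|\lambda(x)-\lambda(y)|$ for all $x,y\in P$, where $d_G$ is the distance in $G$. A partition $\mathcal{P}$ of an ordered graph $G$ is a sequence $P_1,\ldots,P_m$ of pairwise disjoint sets with union $V(G)$ such that $u\prec v$ whenever $u\in P_i$, $v\in P_j$, $i<j$. It is width-$d$ geodesic if for each $i$, $G[P_i]$ has a $G[P_i\cup P_{i+1}\cup\cdots\cup P_m]$-geodesic layering of width at most $d$. $G/\mathcal{P}$ is the ordered graph obtained by identifying each part to a single vertex and suppressing loops and parallel edges, ordered according to the sequence of parts. For a class $\mathcal{C}$ of ordered graphs, $\mathcal{C}^{(d)}$ is the class of ordered graphs $G$ having a width-$d$ geodesic partition $\mathcal{P}$ with $G/\mathcal{P}\in\mathcal{C}$. For an infinite integer sequence $\mathbf{r}=r_1,r_2,\ldots$, let $\mathrm{head}(\mathbf{r})=r_1$ and $\mathrm{tail}(\mathbf{r})=r_2,r_3,\ldots$. The Baker game between Destroyer and Preserver has states $(G,\mathbf{r})$ with $G$ an ordered graph. If $V(G)=\emptyset$ the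 game stops. Otherwise Destroyer chooses one action (one round): Delete — the smallest vertex $v$ of $G$ is deleted and the state becomes $(G-v,\mathrm{tail}(\mathbf{r}))$; or Restrict — Destroyer chooses a layering $\lambda$ of $G$, Preserver chooses an interval $I$ of at most $\mathrm{head}(\mathbf{r})$ consecutive integers, and the state becomes $(G[\lambda^{ -1}(I)],\mathrm{tail}(\mathbf{r}))$. Destroyer wins on $(G,\mathbf{r})$ in $t$ rounds if he has a strategy such that, regardless of Preserver's choices, the game stops after at most $t$ rounds. A class $\mathcal{C}$ of ordered graphs is a Baker class if for every infinite integer sequence $\mathbf{r}$ there exists an integer $t$ such that for each $G\in\mathcal{C}$, Destroyer wins on $(G,\mathbf{r})$ in $t$ rounds. -}

module Defs where

open import Data.Nat using (ℕ; zero; suc; _+_) renaming (_≤_ to _≤ℕ_)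
open import Data.Integer as ℤ using (ℤ; +_; ∣_∣; _-_)
open import Data.Fin as Fin using (Fin; zero; suc)
open import Data.Bool using (Bool; true; false; _∧_; if_then_else_)
open import Data.Product using (Σ; Σ-syntax; ∃; ∃-syntax; _×_; _,_)
open import Data.Sum using (_⊎_)
open import Function using (_∘_)
open import Relation.Binary.PropositionalEquality using (_≡_; _≢_)
open import Relation.Nullary.Decidable using (⌊_⌋)

-- An ordered graph with n vertices has vertex set Fin n,
-- ordered by the natural order of Fin n (every finite ordered graph is
-- order-isomorphic to exactly one such graph).

record OGraph : Set where
  field
    n      : ℕ
    adj    : Fin n → Fin n → Bool
    sym    : ∀ u v → adj u v ≡ adj v u
    irrefl : ∀ u → adj u u ≡ false

open OGraph public

Class : Set₁
Class = OGraph → Set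

-- Vertex subsets (decidable), used to describe induced subgraphs G[S].
VSet : ℕ → Set
VSet n = Fin n → Bool

full : ∀ {n} → VSet n
full _ = true

IsEmpty : ∀ {n} → VSet n → Set
IsEmpty S = ∀ v → S v ≡ false

count : ∀ {n} → VSet n → ℕ
count {zero}  S = 0
count {suc n} S = (if S zero then 1 else 0) + count (S ∘ suc)

deleteMin : ∀ {n} → VSet n → VSet n
deleteMin {suc n} S zero    = false
deleteMin {suc n} S (suc i) = if S zero then S (suc i) else deleteMin (S ∘ suc) i

-- Layerings of the induced subgraph G[S] (a function on S, given as a
-- function on all of V(G) whose values outside S are irrelevant).

IsLayering : (G : OGraph) → VSet (n G) → (Fin (n G) → ℤ) → Set
IsLayering G S λ′ = ∀ u v → S u ≡ true → S v ≡ true → adj G u v ≡ true →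
                    ∣ λ′ u - λ′ v ∣ ≤ℕ 1

WidthAtMost : ∀ {n} → ℕ → VSet n → (Fin n → ℤ) → Set
WidthAtMost d S λ′ = ∀ (z : ℤ) → count (λ v → S v ∧ ⌊ λ′ v ℤ.≟ z ⌋) ≤ℕ d

-- Walks inside the induced subgraph G[Q]; a walk of length k from x to y
-- exists iff d_{G[Q]}(x,y) ≤ k.

data Walk (G : OGraph) (Q : Fin (n G) → Set) : Fin (n G) → Fin (n G) → ℕ → Set where
  here : ∀ {x} → Q x → Walk G Q x x 0
  step : ∀ {x z y k} → Q x → adj G x z ≡ true → Walk G Q z y k → Walk G Q x y (suc k)

-- d_{G[Q]}(x,y) ≥ m  (true also when x, y are in different components)
DistAtLeast : (G : OGraph) → (Fin (n G) → Set) → Fin (n G) → Fin (n G) → ℕ → Set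
DistAtLeast G Q x y m = ∀ k → Walk G Q x y k → m ≤ℕ k

-- Partitions P_1,...,P_m of an ordered graph given by the part index
-- function  part : V(G) → Fin m  (v ∈ P_{part v}); parts are nonempty
-- (surjectivity) and ordered consistently with ≺.

IsOrderedPartition : (G : OGraph) (m : ℕ) → (Fin (n G) → Fin m) → Set
IsOrderedPartition G m part =
  (∀ (i : Fin m) → ∃[ v ] part v ≡ i) ×
  (∀ u v → part u Fin.< part v → u Fin.< v)

InPart : ∀ {k m} → (Fin k → Fin m) → Fin m → VSet k
InPart part i v = ⌊ part v Fin.≟ i ⌋

IsGeodesicPartition : (d : ℕ) (G : OGraph) (m : ℕ) → (Fin (n G) → Fin m) → Set
IsGeodesicPartition d G m part =
  ∀ (i : Fin m) → Σ[ λ′ ∈ (Fin (n G) → ℤ) ]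
      IsLayering G (InPart part i) λ′ ×
      WidthAtMost d (InPart part i) λ′ ×
      (∀ x y → InPart part i x ≡ true → InPart part i y ≡ true →
         DistAtLeast G (λ v → i Fin.≤ part v) x y ∣ λ′ x - λ′ y ∣)

-- H is (equal to) the ordered quotient G/P, where P is given by part
-- (parts of P are the vertices of H, in their order).
IsQuotient : (G H : OGraph) → (Fin (n G) → Fin (n H)) → Set
IsQuotient G H part =
  ∀ i j → (adj H i j ≡ true →
             i ≢ j × ∃[ u ] ∃[ v ] (part u ≡ i × part v ≡ j × adj G u v ≡ true)) ×
          (i ≢ j → ∀ u v → part u ≡ i → part v ≡ j → adj G u v ≡ true →
             adj H i j ≡ true)

Widen : ℕ → Class → Class
Widen d C G =
  Σ[ H ∈ OGraph ] Σ[ part ∈ (Fin (n G) → Fin (n H)) ]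
    IsOrderedPartition G (n H) part ×
    IsGeodesicPartition d G (n H) part ×
    IsQuotient G H part ×
    C H

-- A state is (G[S], r) with r : ℕ → ℤ (head r = r 0,
-- tail r = r ∘ suc).  Wins G S r t : Destroyer wins on (G[S], r) in at
-- most t rounds.  Preserver's interval is {a, ..., a+k-1} with 0 ≤ k ≤ head r.

Wins : (G : OGraph) → VSet (n G) → (ℕ → ℤ) → ℕ → Set
Wins G S r zero    = IsEmpty S
Wins G S r (suc t) =
  IsEmpty S ⊎
  (Wins G (deleteMin S) (r ∘ suc) t ⊎
   Σ[ λ′ ∈ (Fin (n G) → ℤ) ] IsLayering G S λ′ ×
     (∀ (a : ℤ) (k : ℕ) → + k ℤ.≤ r 0 →
        Wins G (λ v → S v ∧ ⌊ a ℤ.≤? λ′ v ⌋ ∧ ⌊ λ′ v ℤ.<? a ℤ.+ + k ⌋) (r ∘ suc) t))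

IsBakerClass : Class → Set
IsBakerClass C = ∀ (r : ℕ → ℤ) → ∃[ t ] (∀ G → C G → Wins G full r t)

module Submission where

-- Destroyer on G simulates a winning strategy on the quotient H = G/𝒫, keeping the
-- vertices left in G inside the union of the parts left in H. A layering μ of H lifts
-- to the layering μ ∘ part of G. Deleting the least part P_p of H is simulated by a
-- Restrict move: extend the geodesic layering λ of P_p to the remaining graph
-- G[P_p ∪ …] by μ(v) = min over x ∈ P_p of λ(x) + d(x, v); this is a layering, and it
-- agrees with λ on P_p precisely because λ is geodesic. After Preserver keeps k ≤ r₁
-- layers at most k·d vertices of P_p survive; they precede all other remaining
-- vertices, so d·|r₁| deletions remove them. Each round on H thus costs 1 + d·|r₁|
-- rounds on G.

open import Defs hiding (sym)
open import Data.Nat as ℕ using (ℕ; zero; suc; z≤n; s≤s; _≤_; _<_)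
import Data.Nat.Properties as ℕP
open import Algebra.Properties.CommutativeSemigroup ℕP.+-commutativeSemigroup
  using () renaming (interchange to +-interchange)
open import Data.Integer as ℤ using (ℤ; +_; -[1+_]; ∣_∣; _-_; +≤+; -≤+)
import Data.Integer.Properties as ℤP
open import Data.Integer.Tactic.RingSolver using (solve-∀)
open import Data.Fin as Fin using (Fin; zero; suc; toℕ)
import Data.Fin.Properties as FinP
open import Data.Bool as Bool using (Bool; true; false; _∧_; _∨_; if_then_else_)
open import Data.Bool.Properties using (∧-zeroʳ)
open import Data.Product using (Σ-syntax; ∃-syntax; _×_; _,_; proj₁; proj₂)
open import Data.Sum using (_⊎_; inj₁; inj₂)
open import Function using (_∘_)
open import Relation.Binary.PropositionalEquality
  using (_≡_; _≢_; refl; sym; trans; cong; subst)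
open import Relation.Nullary using (¬_; Dec; yes; no; contradiction)
open import Relation.Nullary.Decidable using (⌊_⌋)

i≤+∣i∣ : ∀ i → i ℤ.≤ + ∣ i ∣
i≤+∣i∣ (+ n)    = ℤP.≤-refl
i≤+∣i∣ -[1+ n ] = -≤+

i≤j+k⇒i-j≤k : ∀ {i j k} → i ℤ.≤ j ℤ.+ k → i - j ℤ.≤ k
i≤j+k⇒i-j≤k {i} {j} {k} h = subst (i - j ℤ.≤_) (cancel j k) (ℤP.+-monoˡ-≤ (ℤ.- j) h)
  where
  cancel : ∀ j k → j ℤ.+ k - j ≡ k
  cancel = solve-∀

i-j≤k⇒i≤j+k : ∀ {i j k} → i - j ℤ.≤ k → i ℤ.≤ j ℤ.+ k
i-j≤k⇒i≤j+k {i} {j} {k} h = subst (ℤ._≤ j ℤ.+ k) (cancel i j) (ℤP.+-monoʳ-≤ j h)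
  where
  cancel : ∀ i j → j ℤ.+ (i - j) ≡ i
  cancel = solve-∀

∣i-j∣≤k⇒j≤i+k : ∀ i j {k} → ∣ i - j ∣ ≤ k → j ℤ.≤ i ℤ.+ + k
∣i-j∣≤k⇒j≤i+k i j h = i-j≤k⇒i≤j+k (ℤP.≤-trans (i≤+∣i∣ (j - i))
  (+≤+ (subst (_≤ _) (ℤP.∣i-j∣≡∣j-i∣ i j) h)))

i≤j+k∧j≤i+k⇒∣i-j∣≤k : ∀ {i j k} → i ℤ.≤ j ℤ.+ + k → j ℤ.≤ i ℤ.+ + k →
                      ∣ i - j ∣ ≤ k
i≤j+k∧j≤i+k⇒∣i-j∣≤k {i} {j} i≤j+k j≤i+k with ℤP.≤-total i j
... | inj₁ i≤j = ℤP.drop‿+≤+ (subst (ℤ._≤ _) (sym (ℤP.∣-∣-≤ i≤j)) (i≤j+k⇒i-j≤k j≤i+k))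
... | inj₂ j≤i = ℤP.drop‿+≤+
  (subst (ℤ._≤ _) (trans (sym (ℤP.∣-∣-≤ j≤i)) (cong +_ (ℤP.∣i-j∣≡∣j-i∣ j i))) (i≤j+k⇒i-j≤k i≤j+k))

i+[1+k]≡i+k+1 : ∀ i k → i ℤ.+ + suc k ≡ i ℤ.+ + k ℤ.+ + 1
i+[1+k]≡i+k+1 i k =
  trans (cong (λ z → i ℤ.+ z) (ℤP.+-comm (+ 1) (+ k))) (sym (ℤP.+-assoc i (+ k) (+ 1)))

i<j+1⇒i≤j : ∀ {i j} → i ℤ.< j ℤ.+ + 1 → i ℤ.≤ j
i<j+1⇒i≤j {i} {j} h = subst (i ℤ.≤_) (pred-inverse j) (ℤP.i<j⇒i≤pred[j] h)
  where
  pred-inverse : ∀ j → ℤ.pred (j ℤ.+ + 1) ≡ j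
  pred-inverse j = trans (cong ℤ.pred (ℤP.+-comm j (+ 1))) (ℤP.pred-suc j)

+k≤i⇒k≤∣i∣ : ∀ {k i} → + k ℤ.≤ i → k ≤ ∣ i ∣
+k≤i⇒k≤∣i∣ (+≤+ k≤m) = k≤m

∧-true⁻ : ∀ a {b} → a ∧ b ≡ true → a ≡ true × b ≡ true
∧-true⁻ true e = refl , e

∧-true⁺ : ∀ {a b} → a ≡ true → b ≡ true → a ∧ b ≡ true
∧-true⁺ refl e = e

∨-true⁻ : ∀ a {b} → a ∨ b ≡ true → a ≡ true ⊎ b ≡ true
∨-true⁻ true  _ = inj₁ refl
∨-true⁻ false e = inj₂ e

∨-true⁺ʳ : ∀ a {b} → b ≡ true → a ∨ b ≡ true
∨-true⁺ʳ true  _ = refl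
∨-true⁺ʳ false e = e

isYes⇒ : ∀ {A : Set} (a? : Dec A) → ⌊ a? ⌋ ≡ true → A
isYes⇒ (yes a) _ = a
isYes⇒ (no _) ()

⇒isYes : ∀ {A : Set} (a? : Dec A) → A → ⌊ a? ⌋ ≡ true
⇒isYes (yes _)  _ = refl
⇒isYes (no ¬a) a = contradiction a ¬a

¬⇒isNo : ∀ {A : Set} (a? : Dec A) → ¬ A → ⌊ a? ⌋ ≡ false
¬⇒isNo (yes a) ¬a = contradiction a ¬a
¬⇒isNo (no _)  _  = refl

inWindow : ℤ → ℕ → ℤ → Bool
inWindow a k z = ⌊ a ℤ.≤? z ⌋ ∧ ⌊ z ℤ.<? a ℤ.+ + k ⌋

inWindow-zero : ∀ a z → inWindow a 0 z ≡ false
inWindow-zero a z with a ℤ.≤? z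
... | no  _   = refl
... | yes a≤z = ¬⇒isNo (z ℤ.<? a ℤ.+ + 0)
                  (ℤP.≤⇒≯ a≤z ∘ subst (z ℤ.<_) (ℤP.+-identityʳ a))

inWindow-suc : ∀ a k z → inWindow a (suc k) z ≡ true → inWindow a k z ≡ true ⊎ z ≡ a ℤ.+ + k
inWindow-suc a k z e with ∧-true⁻ ⌊ a ℤ.≤? z ⌋ e
... | a≤z , z<a+1+k with z ℤ.<? a ℤ.+ + k
...   | yes _   = inj₁ (∧-true⁺ a≤z refl)
...   | no  z≮a+k = inj₂ (ℤP.≤-antisym
          (i<j+1⇒i≤j (subst (z ℤ.<_) (i+[1+k]≡i+k+1 a k)
                                (isYes⇒ (z ℤ.<? a ℤ.+ + suc k) z<a+1+k)))
          (ℤP.≮⇒≥ z≮a+k))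

indicator : Bool → ℕ
indicator b = if b then 1 else 0

indicator-mono : ∀ a b → (a ≡ true → b ≡ true) → indicator a ≤ indicator b
indicator-mono false _     _ = z≤n
indicator-mono true  true  _ = ℕP.≤-refl
indicator-mono true  false h with h refl
... | ()

indicator-∨ : ∀ a b c → (c ≡ true → a ≡ true ⊎ b ≡ true) → indicator c ≤ indicator a ℕ.+ indicator b
indicator-∨ a     b     false _ = z≤n
indicator-∨ true  b     true  _ = s≤s z≤n
indicator-∨ false true  true  _ = s≤s z≤n
indicator-∨ false false true  h with h refl
... | inj₁ ()
... | inj₂ ()

count-empty : ∀ {n} (A : VSet n) → IsEmpty A → count A ≡ 0
count-empty {zero}  A h = refl
count-empty {suc n} A h rewrite h zero = count-empty (A ∘ suc) (h ∘ suc)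

count-mono : ∀ {n} (A B : VSet n) → (∀ v → A v ≡ true → B v ≡ true) → count A ≤ count B
count-mono {zero}  A B h = z≤n
count-mono {suc n} A B h =
  ℕP.+-mono-≤ (indicator-mono (A zero) (B zero) (h zero)) (count-mono (A ∘ suc) (B ∘ suc) (h ∘ suc))

count-< : ∀ {n} (A B : VSet n) → (∀ v → A v ≡ true → B v ≡ true) →
          ∀ w → B w ≡ true → A w ≡ false → count A < count B
count-< {suc n} A B h zero    bw aw rewrite aw | bw = s≤s (count-mono (A ∘ suc) (B ∘ suc) (h ∘ suc))
count-< {suc n} A B h (suc w) bw aw =
  ℕP.≤-trans (ℕP.≤-reflexive (sym (ℕP.+-suc (indicator (A zero)) (count (A ∘ suc)))))
    (ℕP.+-mono-≤ (indicator-mono (A zero) (B zero) (h zero))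
                 (count-< (A ∘ suc) (B ∘ suc) (h ∘ suc) w bw aw))

count-∪ : ∀ {n} (A B C : VSet n) → (∀ v → C v ≡ true → A v ≡ true ⊎ B v ≡ true) →
          count C ≤ count A ℕ.+ count B
count-∪ {zero}  A B C h = z≤n
count-∪ {suc n} A B C h = begin
  indicator (C zero) ℕ.+ count (C ∘ suc)
    ≤⟨ ℕP.+-mono-≤ (indicator-∨ (A zero) (B zero) (C zero) (h zero))
                   (count-∪ (A ∘ suc) (B ∘ suc) (C ∘ suc) (h ∘ suc)) ⟩
  (indicator (A zero) ℕ.+ indicator (B zero)) ℕ.+ (count (A ∘ suc) ℕ.+ count (B ∘ suc))
    ≡⟨ +-interchange (indicator (A zero)) (indicator (B zero)) (count (A ∘ suc)) (count (B ∘ suc)) ⟩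
  (indicator (A zero) ℕ.+ count (A ∘ suc)) ℕ.+ (indicator (B zero) ℕ.+ count (B ∘ suc)) ∎
  where open ℕP.≤-Reasoning

count-window : ∀ {n d} (P : VSet n) (f : Fin n → ℤ) → WidthAtMost d P f →
               ∀ a k → count (λ v → P v ∧ inWindow a k (f v)) ≤ k ℕ.* d
count-window P f width a zero = ℕP.≤-reflexive (count-empty _ λ v →
  trans (cong (P v ∧_) (inWindow-zero a (f v))) (∧-zeroʳ (P v)))
count-window {d = d} P f width a (suc k) = begin
  count (λ v → P v ∧ inWindow a (suc k) (f v))
    ≤⟨ count-∪ _ _ _ split ⟩
  count (λ v → P v ∧ inWindow a k (f v)) ℕ.+ count (λ v → P v ∧ ⌊ f v ℤ.≟ a ℤ.+ + k ⌋)
    ≤⟨ ℕP.+-mono-≤ (count-window P f width a k) (width (a ℤ.+ + k)) ⟩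
  k ℕ.* d ℕ.+ d
    ≡⟨ ℕP.+-comm (k ℕ.* d) d ⟩
  suc k ℕ.* d ∎
  where
  open ℕP.≤-Reasoning
  split : ∀ v → P v ∧ inWindow a (suc k) (f v) ≡ true →
          P v ∧ inWindow a k (f v) ≡ true ⊎ P v ∧ ⌊ f v ℤ.≟ a ℤ.+ + k ⌋ ≡ true
  split v e with ∧-true⁻ (P v) e
  ... | pv , w with inWindow-suc a k (f v) w
  ...   | inj₁ w′ = inj₁ (∧-true⁺ pv w′)
  ...   | inj₂ eq = inj₂ (∧-true⁺ pv (⇒isYes (f v ℤ.≟ a ℤ.+ + k) eq))

deleteMin-⊆ : ∀ {n} (S : VSet n) v → deleteMin S v ≡ true →
              S v ≡ true × ∃[ u ] (u Fin.< v × S u ≡ true)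
deleteMin-⊆ {suc n} S (suc v) h with S zero in e
... | true  = h , zero , s≤s z≤n , e
... | false with deleteMin-⊆ (S ∘ suc) v h
...   | sv , u , u<v , su = sv , suc u , s≤s u<v , su

deleteMin-keeps : ∀ {n} (S : VSet n) v u → S v ≡ true → u Fin.< v → S u ≡ true → deleteMin S v ≡ true
deleteMin-keeps {suc n} S (suc v) zero    sv _         su rewrite su = sv
deleteMin-keeps {suc n} S (suc v) (suc u) sv (s≤s u<v) su with S zero
... | true  = sv
... | false = deleteMin-keeps (S ∘ suc) v u sv u<v su

DownClosed : ∀ {n} → VSet n → Set
DownClosed T = ∀ x y → x Fin.≤ y → T y ≡ true → T x ≡ true

count-deleteMin : ∀ {n} (S T : VSet n) → DownClosed T → ∀ u → S u ≡ true → T u ≡ true →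
                  count (λ v → deleteMin S v ∧ T v) < count (λ v → S v ∧ T v)
count-deleteMin {suc n} S T closed u su tu with S zero in e
... | true rewrite closed zero u z≤n tu = s≤s ℕP.≤-refl
count-deleteMin {suc n} S T closed zero    su tu | false = contradiction (trans (sym su) e) λ ()
count-deleteMin {suc n} S T closed (suc u) su tu | false =
  count-deleteMin (S ∘ suc) (T ∘ suc) (λ x y x≤y → closed (suc x) (suc y) (s≤s x≤y)) u su tu

deleteMins : ∀ {n} → ℕ → VSet n → VSet n
deleteMins zero    S = S
deleteMins (suc j) S = deleteMins j (deleteMin S)

below : ∀ {n} → Fin n → VSet n
below v u = ⌊ u Fin.<? v ⌋

below-closed : ∀ {n} (v : Fin n) → DownClosed (below v)
below-closed v x y x≤y y<v = ⇒isYes (x Fin.<? v) (ℕP.≤-<-trans x≤y (isYes⇒ (y Fin.<? v) y<v))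

deleteMins-sound : ∀ {n} j (S : VSet n) v → deleteMins j S v ≡ true →
                   S v ≡ true × j ≤ count (λ u → S u ∧ below v u)
deleteMins-sound zero    S v h = h , z≤n
deleteMins-sound (suc j) S v h with deleteMins-sound j (deleteMin S) v h
... | dv , j≤ with deleteMin-⊆ S v dv
...   | sv , u , u<v , su =
  sv , ℕP.≤-trans (s≤s j≤)
         (count-deleteMin S (below v) (below-closed v) u su (⇒isYes (u Fin.<? v) u<v))

deleteMins-clears : ∀ {n} j (T P : VSet n) →
  (∀ u v → T u ≡ true → T v ≡ true → P v ≡ true → u Fin.< v → P u ≡ true) →
  count (λ u → T u ∧ P u) ≤ j → ∀ v → deleteMins j T v ≡ true → P v ≢ true
deleteMins-clears j T P initial bound v h pv with deleteMins-sound j T v h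
... | tv , j≤ = ℕP.<-irrefl refl (ℕP.≤-trans (ℕP.≤-trans (s≤s j≤) fewer) bound)
  where
  fewer : count (λ u → T u ∧ below v u) < count (λ u → T u ∧ P u)
  fewer = count-< _ _ (λ u e → let tu , u<v = ∧-true⁻ (T u) e in
                                ∧-true⁺ tu (initial u v tu tv pv (isYes⇒ (u Fin.<? v) u<v)))
            v (∧-true⁺ tv pv)
            (trans (cong (T v ∧_) (¬⇒isNo (v Fin.<? v) (FinP.<-irrefl refl))) (∧-zeroʳ (T v)))

least-or-empty : ∀ {m} (S : VSet m) →
                 IsEmpty S ⊎ ∃[ p ] (S p ≡ true × (∀ q → q Fin.< p → S q ≡ false))
least-or-empty {zero}  S = inj₁ λ ()
least-or-empty {suc m} S with S zero in e
... | true  = inj₂ (zero , e , λ q ())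
... | false with least-or-empty (S ∘ suc)
...   | inj₁ empty = inj₁ λ { zero → e ; (suc i) → empty i }
...   | inj₂ (p , sp , least) =
  inj₂ (suc p , sp , λ { zero _ → e ; (suc q) (s≤s q<p) → least q q<p })

maxᶠ : ∀ {m} → (Fin m → ℕ) → ℕ
maxᶠ {zero}  g = 0
maxᶠ {suc m} g = g zero ℕ.⊔ maxᶠ (g ∘ suc)

≤-maxᶠ : ∀ {m} (g : Fin m → ℕ) i → g i ≤ maxᶠ g
≤-maxᶠ {suc m} g zero    = ℕP.m≤m⊔n _ _
≤-maxᶠ {suc m} g (suc i) = ℕP.≤-trans (≤-maxᶠ (g ∘ suc) i) (ℕP.m≤n⊔m _ _)

minWhere : ∀ {m} → (Fin m → Bool) → (Fin m → ℤ) → ℤ → ℤ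
minWhere {zero}  P g a = a
minWhere {suc m} P g a = if P zero then g zero ℤ.⊓ rest else rest
  where rest = minWhere (P ∘ suc) (g ∘ suc) a

minWhere-≤-default : ∀ {m} (P : Fin m → Bool) g a → minWhere P g a ℤ.≤ a
minWhere-≤-default {zero}  P g a = ℤP.≤-refl
minWhere-≤-default {suc m} P g a with P zero
... | true  = ℤP.i≤j⇒k⊓i≤j (g zero) (minWhere-≤-default (P ∘ suc) (g ∘ suc) a)
... | false = minWhere-≤-default (P ∘ suc) (g ∘ suc) a

minWhere-≤ : ∀ {m} (P : Fin m → Bool) g a i → P i ≡ true → minWhere P g a ℤ.≤ g i
minWhere-≤ {suc m} P g a zero    pi rewrite pi = ℤP.i⊓j≤i (g zero) _
minWhere-≤ {suc m} P g a (suc i) pi with P zero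
... | true  = ℤP.i≤j⇒k⊓i≤j (g zero) (minWhere-≤ (P ∘ suc) (g ∘ suc) a i pi)
... | false = minWhere-≤ (P ∘ suc) (g ∘ suc) a i pi

≤-minWhere : ∀ {m} (P : Fin m → Bool) g a {b} → b ℤ.≤ a → (∀ i → P i ≡ true → b ℤ.≤ g i) →
             b ℤ.≤ minWhere P g a
≤-minWhere {zero}  P g a b≤a b≤g = b≤a
≤-minWhere {suc m} P g a b≤a b≤g with P zero in e
... | true  = ℤP.⊓-glb (b≤g zero e) (≤-minWhere (P ∘ suc) (g ∘ suc) a b≤a (b≤g ∘ suc))
... | false = ≤-minWhere (P ∘ suc) (g ∘ suc) a b≤a (b≤g ∘ suc)

minWhere-+ : ∀ {m} (P : Fin m → Bool) g a c →
             minWhere P g a ℤ.+ c ≡ minWhere P (λ i → g i ℤ.+ c) (a ℤ.+ c)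
minWhere-+ {zero}  P g a c = refl
minWhere-+ {suc m} P g a c with P zero
... | true  = trans (ℤP.mono-≤-distrib-⊓ {ℤ._+ c} (ℤP.+-monoˡ-≤ c) (g zero) _)
                    (cong (λ z → (g zero ℤ.+ c) ℤ.⊓ z) (minWhere-+ (P ∘ suc) (g ∘ suc) a c))
... | false = minWhere-+ (P ∘ suc) (g ∘ suc) a c

walk-snoc : ∀ {G Q x u j v} → Walk G Q x u j → Q v → adj G u v ≡ true → Walk G Q x v (suc j)
walk-snoc (here qx)       qv uv = step qx uv (here qv)
walk-snoc (step qx xz w)  qv uv = step qx xz (walk-snoc w qv uv)

module GeodesicExtension
  (G : OGraph) {Q : Fin (n G) → Set} (Q? : ∀ v → Dec (Q v))
  (P : VSet (n G)) (P⊆Q : ∀ v → P v ≡ true → Q v) (f : Fin (n G) → ℤ)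
  (geodesic : ∀ x y → P x ≡ true → P y ≡ true → DistAtLeast G Q x y ∣ f x - f y ∣)
  where

  reachable : ℕ → Fin (n G) → Fin (n G) → Bool
  reachable zero    x v = ⌊ x Fin.≟ v ⌋ ∧ ⌊ Q? x ⌋
  reachable (suc k) x v =
    reachable k x v ∨ ⌊ Q? v ⌋ ∧ ⌊ FinP.any? (λ u → reachable k x u ∧ adj G u v Bool.≟ true) ⌋

  reachable⇒walk : ∀ k x v → reachable k x v ≡ true → ∃[ j ] (j ≤ k × Walk G Q x v j)
  reachable⇒walk zero x v e with ∧-true⁻ ⌊ x Fin.≟ v ⌋ e
  ... | x≡v , qx with isYes⇒ (x Fin.≟ v) x≡v
  ...   | refl = 0 , z≤n , here (isYes⇒ (Q? x) qx)
  reachable⇒walk (suc k) x v e with ∨-true⁻ (reachable k x v) e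
  ... | inj₁ e′ with reachable⇒walk k x v e′
  ...   | j , j≤k , w = j , ℕP.m≤n⇒m≤1+n j≤k , w
  reachable⇒walk (suc k) x v e | inj₂ e′ with ∧-true⁻ ⌊ Q? v ⌋ e′
  ... | qv , edge with isYes⇒ (FinP.any? (λ u → reachable k x u ∧ adj G u v Bool.≟ true)) edge
  ...   | u , ru∧uv with ∧-true⁻ (reachable k x u) ru∧uv
  ...     | ru , uv with reachable⇒walk k x u ru
  ...       | j , j≤k , w = suc j , s≤s j≤k , walk-snoc w (isYes⇒ (Q? v) qv) uv

  reachable-step : ∀ k x u v → Q v → adj G u v ≡ true →
                   reachable k x u ≡ true → reachable (suc k) x v ≡ true
  reachable-step k x u v qv uv ru = ∨-true⁺ʳ (reachable k x v)
    (∧-true⁺ (⇒isYes (Q? v) qv)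
             (⇒isYes (FinP.any? (λ w → reachable k x w ∧ adj G w v Bool.≟ true)) (u , ∧-true⁺ ru uv)))

  B : ℕ
  B = maxᶠ (∣_∣ ∘ f)

  -- M bounds both |f y| and |f x - f y|, so capping distances at M does not change extension on P.
  M : ℕ
  M = B ℕ.+ B

  reachableWithin : Fin (n G) → Fin (n G) → Fin (suc M) → Bool
  reachableWithin x v k = reachable (toℕ k) x v

  shift : Fin (n G) → Fin (suc M) → ℤ
  shift x k = f x ℤ.+ + toℕ k

  cost : Fin (n G) → Fin (n G) → ℤ
  cost x v = minWhere (reachableWithin x v) (shift x) (f x ℤ.+ + M)

  -- extension v = min (M, min over x ∈ P of f x + d_{G[Q]}(x, v)), distances capped at M.
  extension : Fin (n G) → ℤ
  extension v = minWhere P (λ x → cost x v) (+ M)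

  cost-≤ : ∀ x v j → reachable j x v ≡ true → cost x v ℤ.≤ f x ℤ.+ + j
  cost-≤ x v j r with j ℕ.≤? M
  ... | yes j≤M = subst (λ i → cost x v ℤ.≤ f x ℤ.+ + i) (FinP.toℕ-fromℕ< (s≤s j≤M))
                    (minWhere-≤ (reachableWithin x v) (shift x) _ (Fin.fromℕ< (s≤s j≤M))
                       (subst (λ i → reachable i x v ≡ true) (sym (FinP.toℕ-fromℕ< (s≤s j≤M))) r))
  ... | no  j≰M = ℤP.≤-trans (minWhere-≤-default (reachableWithin x v) (shift x) _)
                    (ℤP.+-monoʳ-≤ (f x) (+≤+ (ℕP.<⇒≤ (ℕP.≰⇒> j≰M))))

  extension-≤-cost : ∀ x v → P x ≡ true → extension v ℤ.≤ cost x v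
  extension-≤-cost x v px = minWhere-≤ P (λ y → cost y v) (+ M) x px

  extension-step : ∀ u v → Q v → adj G u v ≡ true → extension v ℤ.≤ extension u ℤ.+ + 1
  extension-step u v qv uv = subst (extension v ℤ.≤_) (sym (minWhere-+ P (λ x → cost x u) (+ M) (+ 1)))
    (≤-minWhere P (λ x → cost x u ℤ.+ + 1) (+ M ℤ.+ + 1)
       (ℤP.≤-trans (minWhere-≤-default P (λ x → cost x v) (+ M)) (ℤP.i≤i+j (+ M) (+ 1))) viaSource)
    where
    viaSource : ∀ x → P x ≡ true → extension v ℤ.≤ cost x u ℤ.+ + 1
    viaSource x px = subst (extension v ℤ.≤_)
      (sym (minWhere-+ (reachableWithin x u) (shift x) (f x ℤ.+ + M) (+ 1)))
      (≤-minWhere (reachableWithin x u) (λ k → shift x k ℤ.+ + 1) (f x ℤ.+ + M ℤ.+ + 1)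
         (ℤP.≤-trans ext≤cost
           (ℤP.≤-trans (minWhere-≤-default (reachableWithin x v) (shift x) _) (ℤP.i≤i+j _ (+ 1))))
         viaWalk)
      where
      ext≤cost : extension v ℤ.≤ cost x v
      ext≤cost = extension-≤-cost x v px
      viaWalk : ∀ k → reachable (toℕ k) x u ≡ true → extension v ℤ.≤ f x ℤ.+ + toℕ k ℤ.+ + 1
      viaWalk k r = subst (extension v ℤ.≤_) (i+[1+k]≡i+k+1 (f x) (toℕ k))
        (ℤP.≤-trans ext≤cost (cost-≤ x v (suc (toℕ k)) (reachable-step (toℕ k) x u v qv uv r)))

  f≤cost : ∀ x y → P x ≡ true → P y ≡ true → f y ℤ.≤ cost x y
  f≤cost x y px py = ≤-minWhere (reachableWithin x y) (shift x) (f x ℤ.+ + M)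
    (∣i-j∣≤k⇒j≤i+k (f x) (f y)
       (ℕP.≤-trans (ℤP.∣i-j∣≤∣i∣+∣j∣ (f x) (f y))
                   (ℕP.+-mono-≤ (≤-maxᶠ (∣_∣ ∘ f) x) (≤-maxᶠ (∣_∣ ∘ f) y))))
    λ k r → let j , j≤k , w = reachable⇒walk (toℕ k) x y r in
            ∣i-j∣≤k⇒j≤i+k (f x) (f y) (ℕP.≤-trans (geodesic x y px py j w) j≤k)

  extension-agrees : ∀ y → P y ≡ true → extension y ≡ f y
  extension-agrees y py = ℤP.≤-antisym
    (ℤP.≤-trans (extension-≤-cost y y py)
      (subst (cost y y ℤ.≤_) (ℤP.+-identityʳ (f y))
        (cost-≤ y y 0 (∧-true⁺ (⇒isYes (y Fin.≟ y) refl) (⇒isYes (Q? y) (P⊆Q y py))))))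
    (≤-minWhere P (λ x → cost x y) (+ M)
       (ℤP.≤-trans (i≤+∣i∣ (f y)) (+≤+ (ℕP.≤-trans (≤-maxᶠ (∣_∣ ∘ f) y) (ℕP.m≤m+n B B))))
       λ x px → f≤cost x y px py)

geodesic-extension :
  (G : OGraph) {Q : Fin (n G) → Set} → (∀ v → Dec (Q v)) →
  (P : VSet (n G)) → (∀ v → P v ≡ true → Q v) → (f : Fin (n G) → ℤ) →
  (∀ x y → P x ≡ true → P y ≡ true → DistAtLeast G Q x y ∣ f x - f y ∣) →
  Σ[ μ ∈ (Fin (n G) → ℤ) ]
    (∀ u v → Q u → Q v → adj G u v ≡ true → ∣ μ u - μ v ∣ ≤ 1) × (∀ v → P v ≡ true → μ v ≡ f v)
geodesic-extension G Q? P P⊆Q f geodesic =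
  extension ,
  (λ u v qu qv uv → i≤j+k∧j≤i+k⇒∣i-j∣≤k (extension-step v u qu (trans (OGraph.sym G v u) uv))
                                         (extension-step u v qv uv)) ,
  extension-agrees
  where open GeodesicExtension G Q? P P⊆Q f geodesic

skip : ℕ → (ℕ → ℤ) → ℕ → ℤ
skip j r i = r (j ℕ.+ i)

wins-empty : ∀ G (S : VSet (n G)) r t → IsEmpty S → Wins G S r t
wins-empty G S r zero    empty = empty
wins-empty G S r (suc t) empty = inj₁ empty

wins-deleting : ∀ G j (S : VSet (n G)) r t → Wins G (deleteMins j S) (skip j r) t → Wins G S r (j ℕ.+ t)
wins-deleting G zero    S r t w = w
wins-deleting G (suc j) S r t w = inj₂ (inj₁ (wins-deleting G j (deleteMin S) (r ∘ suc) t w))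

clearance : ℕ → (ℕ → ℤ) → ℕ
clearance d r = d ℕ.* ∣ r 0 ∣

-- A round on G/𝒫 is played as one round on G followed by clearance d r deletions.
quotientSeq : ℕ → (ℕ → ℤ) → ℕ → ℤ
quotientSeq d r zero    = r 0
quotientSeq d r (suc k) = quotientSeq d (skip (suc (clearance d r)) r) k

simulationRounds : ℕ → (ℕ → ℤ) → ℕ → ℕ
simulationRounds d r zero    = 0
simulationRounds d r (suc t) =
  suc (clearance d r ℕ.+ simulationRounds d (skip (suc (clearance d r)) r) t)

module Simulation
  (d : ℕ) (G H : OGraph) (part : Fin (n G) → Fin (n H))
  (ordered : ∀ u v → part u Fin.< part v → u Fin.< v)
  (geodesic : IsGeodesicPartition d G (n H) part) (quotient : IsQuotient G H part)
  where

  Covers : VSet (n H) → VSet (n G) → Set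
  Covers S′ S = ∀ v → S v ≡ true → S′ (part v) ≡ true

  covered-by-empty : ∀ {S′ S} → IsEmpty S′ → Covers S′ S → IsEmpty S
  covered-by-empty {S′} {S} empty covers v with S v in e
  ... | false = refl
  ... | true  = contradiction (trans (sym (covers v e)) (empty (part v))) λ ()

  layering-lift : ∀ {S′ S μ} → Covers S′ S → IsLayering H S′ μ → IsLayering G S (μ ∘ part)
  layering-lift {μ = μ} covers layering u v su sv uv with part u Fin.≟ part v
  ... | yes pu≡pv rewrite pu≡pv | ℤP.+-inverseʳ (μ (part v)) = z≤n
  ... | no  pu≢pv = layering (part u) (part v) (covers u su) (covers v sv)
                      (proj₂ (quotient (part u) (part v)) pu≢pv u v refl refl uv)

  covers-window : ∀ {S′ S} (μ : Fin (n H) → ℤ) a k j → Covers S′ S →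
                  Covers (λ i → S′ i ∧ inWindow a k (μ i))
                         (deleteMins j (λ v → S v ∧ inWindow a k (μ (part v))))
  covers-window {S = S} μ a k j covers v h with ∧-true⁻ (S v) (proj₁ (deleteMins-sound j _ v h))
  ... | sv , w = ∧-true⁺ (covers v sv) w

  module LeastPart {S′ S} (p : Fin (n H)) (p∈S′ : S′ p ≡ true)
    (least : ∀ q → q Fin.< p → S′ q ≡ false) (covers : Covers S′ S) where

    P : VSet (n G)
    P = InPart part p

    p≤part : ∀ v → S v ≡ true → p Fin.≤ part v
    p≤part v sv = ℕP.≮⇒≥ λ q<p → contradiction (trans (sym (covers v sv)) (least (part v) q<p)) λ ()

    part-initial : ∀ u v → S u ≡ true → P v ≡ true → u Fin.< v → P u ≡ true
    part-initial u v su pv u<v = ⇒isYes (part u Fin.≟ p) (FinP.≤-antisym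
      (subst (part u Fin.≤_) (isYes⇒ (part v Fin.≟ p) pv)
        (ℕP.≮⇒≥ λ pv<pu → FinP.<-asym (ordered v u pv<pu) u<v))
      (p≤part u su))

    covers-after-clearing : ∀ (T : VSet (n G)) j → (∀ v → T v ≡ true → S v ≡ true) →
                            count (λ v → T v ∧ P v) ≤ j → Covers (deleteMin S′) (deleteMins j T)
    covers-after-clearing T j T⊆S bound v h =
      deleteMin-keeps S′ (part v) p (covers v sv) (FinP.≤∧≢⇒< (p≤part v sv) p≢part) p∈S′
      where
      sv : S v ≡ true
      sv = T⊆S v (proj₁ (deleteMins-sound j T v h))
      p≢part : p ≢ part v
      p≢part p≡ = deleteMins-clears j T P (λ u w tu _ pw → part-initial u w (T⊆S u tu) pw) bound v h
                    (⇒isYes (part v Fin.≟ p) (sym p≡))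

    f : Fin (n G) → ℤ
    f = proj₁ (geodesic p)

    extension : Σ[ μ ∈ (Fin (n G) → ℤ) ]
      (∀ u v → p Fin.≤ part u → p Fin.≤ part v → adj G u v ≡ true → ∣ μ u - μ v ∣ ≤ 1) ×
      (∀ v → P v ≡ true → μ v ≡ f v)
    extension = geodesic-extension G (λ v → p Fin.≤? part v) P
      (λ v pv → FinP.≤-reflexive (sym (isYes⇒ (part v Fin.≟ p) pv))) f
      (proj₂ (proj₂ (proj₂ (geodesic p))))

    μ : Fin (n G) → ℤ
    μ = proj₁ extension

    μ-layering : IsLayering G S μ
    μ-layering u v su sv = proj₁ (proj₂ extension) u v (p≤part u su) (p≤part v sv)

    count-window-part : ∀ a k → count (λ v → (S v ∧ inWindow a k (μ v)) ∧ P v) ≤ k ℕ.* d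
    count-window-part a k = ℕP.≤-trans (count-mono _ _ onPart)
                              (count-window P f (proj₁ (proj₂ (proj₂ (geodesic p)))) a k)
      where
      onPart : ∀ v → (S v ∧ inWindow a k (μ v)) ∧ P v ≡ true → P v ∧ inWindow a k (f v) ≡ true
      onPart v e with ∧-true⁻ (S v ∧ inWindow a k (μ v)) e
      ... | sw , pv rewrite sym (proj₂ (proj₂ extension) v pv) = ∧-true⁺ pv (proj₂ (∧-true⁻ (S v) sw))

  window≤clearance : ∀ k r → + k ℤ.≤ r 0 → k ℕ.* d ≤ clearance d r
  window≤clearance k r k≤r =
    ℕP.≤-trans (ℕP.*-monoˡ-≤ d (+k≤i⇒k≤∣i∣ k≤r)) (ℕP.≤-reflexive (ℕP.*-comm ∣ r 0 ∣ d))

  simulate : ∀ t r S′ S → Wins H S′ (quotientSeq d r) t → Covers S′ S →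
             Wins G S r (simulationRounds d r t)
  simulate zero    r S′ S empty          covers = covered-by-empty empty covers
  simulate (suc t) r S′ S (inj₁ empty)   covers = wins-empty G S r _ (covered-by-empty empty covers)
  simulate (suc t) r S′ S (inj₂ (inj₂ (μ , layering , next))) covers =
    inj₂ (inj₂ (μ ∘ part , layering-lift {μ = μ} covers layering , λ a k k≤r →
      wins-deleting G (clearance d r) _ (r ∘ suc) _
        (simulate t (skip (suc (clearance d r)) r) _ _ (next a k k≤r)
          (covers-window {S′} {S} μ a k (clearance d r) covers))))
  simulate (suc t) r S′ S (inj₂ (inj₁ next)) covers with least-or-empty S′
  ... | inj₁ empty = wins-empty G S r _ (covered-by-empty empty covers)
  ... | inj₂ (p , p∈S′ , least) =
    inj₂ (inj₂ (μ , μ-layering , λ a k k≤r →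
      wins-deleting G (clearance d r) _ (r ∘ suc) _
        (simulate t (skip (suc (clearance d r)) r) _ _ next
          (covers-after-clearing _ (clearance d r) (λ v → proj₁ ∘ ∧-true⁻ (S v))
            (ℕP.≤-trans (count-window-part a k) (window≤clearance k r k≤r))))))
    where open LeastPart p p∈S′ least covers

lemma5 : (C : Class) → IsBakerClass C → (d : ℕ) → 1 ≤ d → IsBakerClass (Widen d C)
lemma5 C baker d _ r = simulationRounds d r t , λ where
    G (H , part , (_ , ordered) , geodesic , quotient , H∈C) →
      Simulation.simulate d G H part ordered geodesic quotient t r full full (wins H H∈C) (λ _ _ → refl)
  where
  t : ℕ
  t = proj₁ (baker (quotientSeq d r))
  wins : ∀ H → C H → Wins H full (quotientSeq d r) t
  wins = proj₂ (baker (quotientSeq d r))
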